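{- Let $f(t)=\sum_{m=0}^{\infty}a_m t^m$ be a formal power series with complex coefficients and let $z$ be an indeterminate. Then, as an identity of formal power series in $z$ (the series on the left converging coefficientwise, since its $n$-th term is divisible by $z^n$), $$\sum_{n=1}^{\infty}\frac{1}{n}\left\{\sum_{k=0}^n\binom{n}{k}(-1)^k f(zk)\right\} = -f'(0)\,z,$$ where $f'(0)=a_1$. -}

module Defs where

open import Level using (Level)
open import Data.Nat using (ℕ; zero; suc)
open import Data.Nat.Combinatorics using (_C_)
open import Algebra.Bundles using (CommutativeRing)

-- Formal power series over a commutative ring R, represented by their
-- coefficient sequences: (f m) is the coefficient of t^m.
module _ {c ℓ : Level} (R : CommutativeRing c ℓ) where
  open CommutativeRing R using (Carrier; _≈_; _+_; _*_; -_; 0#; 1#)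

  PowerSeries : Set c
  PowerSeries = ℕ → Carrier

  ⟦_⟧ : ℕ → Carrier
  ⟦ zero ⟧ = 0#
  ⟦ suc n ⟧ = 1# + ⟦ n ⟧

  pow : Carrier → ℕ → Carrier
  pow x zero = 1#
  pow x (suc m) = x * pow x m

  sum0to : ℕ → (ℕ → Carrier) → Carrier
  sum0to zero g = g zero
  sum0to (suc n) g = sum0to n g + g (suc n)

  sumBelow : ℕ → (ℕ → Carrier) → Carrier
  sumBelow zero g = 0#
  sumBelow (suc M) g = sumBelow M g + g M

  -- f(z k) as a power series in z: coefficient of z^m is a_m k^m
  subst-zk : PowerSeries → ℕ → PowerSeries
  subst-zk f k m = f m * pow ⟦ k ⟧ m

  -- (1/n) Σ_{k=0}^{n} C(n,k) (-1)^k f(zk), where invn is 1/n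
  term : (invn : Carrier) → ℕ → PowerSeries → PowerSeries
  term invn n f m =
    invn * sum0to n (λ k → (⟦ n C k ⟧ * pow (- 1#) k) * subst-zk f k m)

  -- Partial sum Σ_{n=1}^{M} term n, given inv j = 1/(j+1)
  partialSum : (inv : ℕ → Carrier) → PowerSeries → ℕ → PowerSeries
  partialSum inv f M m = sumBelow M (λ j → term (inv j) (suc j) f m)

  -- Convergence of a sequence of power series in the (z)-adic topology:
  -- every coefficient is eventually constant equal to that of the limit.
  ConvergesTo : (ℕ → PowerSeries) → PowerSeries → Set ℓ
  ConvergesTo S g = ∀ m → ∃N m
    where
    open import Data.Product using (Σ)
    open import Data.Nat using (_≤_)
    ∃N : ℕ → Set ℓ
    ∃N m = Σ ℕ (λ N → ∀ M → N ≤ M → S M m ≈ g m)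

  minusDerivAt0Z : PowerSeries → PowerSeries
  minusDerivAt0Z f zero = 0#
  minusDerivAt0Z f (suc zero) = - (f 1)
  minusDerivAt0Z f (suc (suc m)) = 0#

module Submission where

-- Write Δₙ g = Σ_{k=0}^{n} (-1)^k C(n,k) g(k) for the n-th (signed) finite
-- difference of g : ℕ → R at 0.  The coefficient of z^m in the n-th term of
-- the series is (1/n)·a_m·Δₙ(k ↦ k^m), so everything reduces to the numbers
-- Δₙ(k^m), which are governed by two recurrences:
--   Pascal:      Δₙ₊₁ g = Δₙ g − Δₙ (g ∘ suc),
--   absorption:  Δₙ₊₁ (k ↦ k·g(k)) = (n+1)·(Δₙ₊₁ g − Δₙ g),
-- the latter coming from (k+1)·C(n+1,k+1) = (n+1)·C(n,k).
-- From these, Δₙ(k^m) = 0 whenever m < n, and (1/(j+1))·Δⱼ₊₁(k^{m+1}) is the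
-- difference Δⱼ₊₁(k^m) − Δⱼ(k^m), so the partial sums over n telescope to
-- Δ_M(k^m) − Δ₀(k^m) = −0^m once M > m.

open import Defs
open import Level using (Level)
open import Data.Nat using (ℕ; suc)
open import Algebra.Bundles using (CommutativeRing)

import Data.Nat as ℕ
open import Data.Nat using (zero; _≤_; _<_; s≤s; z≤n)
import Data.Nat.Properties as ℕₚ
open import Data.Nat.Combinatorics using (_C_; nC1≡n; k>n⇒nCk≡0; nCk+nC[k+1]≡[n+1]C[k+1])
open import Data.Nat.Tactic.RingSolver using (solve-∀)
open import Data.Product using (_,_)
open import Data.Maybe using (nothing)
open import Function using (_∘_)
open import Relation.Binary.PropositionalEquality as ≡ using (_≡_)
import Relation.Binary.Reasoning.Setoid as SetoidReasoning
open import Tactic.RingSolver.Core.AlmostCommutativeRing using (fromCommutativeRing)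
import Tactic.RingSolver.NonReflective as RingSolver
open import Tactic.RingSolver.Core.Expression using (_⊕_; ⊝_)

[k+1]*[n+1]C[k+1]≡[n+1]*nCk : ∀ n k → suc k ℕ.* (suc n C suc k) ≡ suc n ℕ.* (n C k)
[k+1]*[n+1]C[k+1]≡[n+1]*nCk n zero =
  ≡.trans (ℕₚ.*-identityˡ _) (≡.trans (nC1≡n (suc n)) (≡.sym (ℕₚ.*-identityʳ _)))
[k+1]*[n+1]C[k+1]≡[n+1]*nCk zero (suc k) = ℕₚ.*-zeroʳ (suc (suc k))
[k+1]*[n+1]C[k+1]≡[n+1]*nCk (suc n) (suc k) = begin
  suc (suc k) ℕ.* (suc (suc n) C suc (suc k))
    ≡⟨ ≡.cong (suc (suc k) ℕ.*_) (≡.sym (pascal (suc n) (suc k))) ⟩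
  suc (suc k) ℕ.* (A ℕ.+ B)
    ≡⟨ expand k A B ⟩
  (suc k ℕ.* A ℕ.+ A) ℕ.+ suc (suc k) ℕ.* B
    ≡⟨ ≡.cong₂ (λ x y → (x ℕ.+ A) ℕ.+ y)
         ([k+1]*[n+1]C[k+1]≡[n+1]*nCk n k) ([k+1]*[n+1]C[k+1]≡[n+1]*nCk n (suc k)) ⟩
  (suc n ℕ.* (n C k) ℕ.+ A) ℕ.+ suc n ℕ.* (n C suc k)
    ≡⟨ collect (suc n) (n C k) (n C suc k) A ⟩
  suc n ℕ.* (n C k ℕ.+ n C suc k) ℕ.+ A
    ≡⟨ ≡.cong (λ x → suc n ℕ.* x ℕ.+ A) (pascal n k) ⟩
  suc n ℕ.* A ℕ.+ A
    ≡⟨ ℕₚ.+-comm (suc n ℕ.* A) A ⟩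
  suc (suc n) ℕ.* A ∎
  where
  open ≡.≡-Reasoning
  pascal = nCk+nC[k+1]≡[n+1]C[k+1]
  A = suc n C suc k
  B = suc n C suc (suc k)
  expand : ∀ k a b → suc (suc k) ℕ.* (a ℕ.+ b) ≡ (suc k ℕ.* a ℕ.+ a) ℕ.+ suc (suc k) ℕ.* b
  expand = solve-∀
  collect : ∀ n x y a → (n ℕ.* x ℕ.+ a) ℕ.+ n ℕ.* y ≡ n ℕ.* (x ℕ.+ y) ℕ.+ a
  collect = solve-∀

module _ {c ℓ : Level} (R : CommutativeRing c ℓ) where
  open CommutativeRing R hiding (zero)
  open import Algebra.Properties.Ring ring
    using (-1*x≈-x; -‿distribˡ-*; -‿distribʳ-*; [y-z]x≈yx-zx; -0#≈0#)
  open import Algebra.Properties.Semiring.Mult semiring using (_×_; ×-homo-+; ×1-homo-*)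
  open import Algebra.Properties.CommutativeSemigroup *-commutativeSemigroup using (x∙yz≈y∙xz)
  open import Algebra.Properties.AbelianGroup +-abelianGroup using (xyx⁻¹≈y)
  open SetoidReasoning setoid
  open RingSolver (fromCommutativeRing R (λ _ → nothing)) using (solve; _⊜_)

  ι : ℕ → Carrier
  ι = ⟦_⟧ R

  ι≈×1# : ∀ n → ι n ≈ n × 1#
  ι≈×1# zero = refl
  ι≈×1# (suc n) = +-congˡ (ι≈×1# n)

  ι-+ : ∀ m n → ι (m ℕ.+ n) ≈ ι m + ι n
  ι-+ m n = begin
    ι (m ℕ.+ n)         ≈⟨ ι≈×1# (m ℕ.+ n) ⟩
    (m ℕ.+ n) × 1#      ≈⟨ ×-homo-+ 1# m n ⟩
    m × 1# + n × 1#     ≈⟨ +-cong (ι≈×1# m) (ι≈×1# n) ⟨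
    ι m + ι n           ∎

  ι-* : ∀ m n → ι (m ℕ.* n) ≈ ι m * ι n
  ι-* m n = begin
    ι (m ℕ.* n)         ≈⟨ ι≈×1# (m ℕ.* n) ⟩
    (m ℕ.* n) × 1#      ≈⟨ ×1-homo-* m n ⟩
    (m × 1#) * (n × 1#) ≈⟨ *-cong (ι≈×1# m) (ι≈×1# n) ⟨
    ι m * ι n           ∎

  sum-cong : ∀ n {g h : ℕ → Carrier} → (∀ k → g k ≈ h k) → sum0to R n g ≈ sum0to R n h
  sum-cong zero    g≈h = g≈h zero
  sum-cong (suc n) g≈h = +-cong (sum-cong n g≈h) (g≈h (suc n))

  sum-*ˡ : ∀ n a g → sum0to R n (λ k → a * g k) ≈ a * sum0to R n g
  sum-*ˡ zero    a g = refl
  sum-*ˡ (suc n) a g = trans (+-congʳ (sum-*ˡ n a g)) (sym (distribˡ a _ _))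

  sum-- : ∀ n g h → sum0to R n (λ k → g k - h k) ≈ sum0to R n g - sum0to R n h
  sum-- zero    g h = refl
  sum-- (suc n) g h = trans (+-congʳ (sum-- n g h)) (regroup _ _ _ _)
    where
    regroup : ∀ a b x y → (a - b) + (x - y) ≈ (a + x) - (b + y)
    regroup = solve 4 (λ a b x y → ((a ⊕ (⊝ b)) ⊕ (x ⊕ (⊝ y))) ⊜ ((a ⊕ x) ⊕ (⊝ (b ⊕ y)))) refl

  sum-shift : ∀ n g → sum0to R (suc n) g ≈ g 0 + sum0to R n (g ∘ suc)
  sum-shift zero    g = refl
  sum-shift (suc n) g = trans (+-congʳ (sum-shift n g)) (+-assoc _ _ _)

  sumBelow-cong : ∀ M {g h : ℕ → Carrier} → (∀ j → g j ≈ h j) → sumBelow R M g ≈ sumBelow R M h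
  sumBelow-cong zero    g≈h = refl
  sumBelow-cong (suc M) g≈h = +-cong (sumBelow-cong M g≈h) (g≈h M)

  sumBelow-*ˡ : ∀ M a g → sumBelow R M (λ j → a * g j) ≈ a * sumBelow R M g
  sumBelow-*ˡ zero    a g = sym (zeroʳ a)
  sumBelow-*ˡ (suc M) a g = trans (+-congʳ (sumBelow-*ˡ M a g)) (sym (distribˡ a _ _))

  sumBelow-vanishes : ∀ M g → (∀ j → g j ≈ 0#) → sumBelow R M g ≈ 0#
  sumBelow-vanishes zero    g g≈0 = refl
  sumBelow-vanishes (suc M) g g≈0 =
    trans (+-cong (sumBelow-vanishes M g g≈0) (g≈0 M)) (+-identityʳ 0#)

  sumBelow-telescope : ∀ (v : ℕ → Carrier) M → sumBelow R M (λ j → v (suc j) - v j) ≈ v M - v 0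
  sumBelow-telescope v zero    = sym (-‿inverseʳ (v 0))
  sumBelow-telescope v (suc M) = begin
    sumBelow R M (λ j → v (suc j) - v j) + (v (suc M) - v M)
      ≈⟨ +-congʳ (sumBelow-telescope v M) ⟩
    (v M - v 0) + (v (suc M) - v M)   ≈⟨ swap (v M) (- v 0) (v (suc M)) (- v M) ⟩
    (v M + (v (suc M) - v 0)) - v M   ≈⟨ xyx⁻¹≈y (v M) _ ⟩
    v (suc M) - v 0                   ∎
    where
    swap : ∀ a b x y → (a + b) + (x + y) ≈ (a + (x + b)) + y
    swap = solve 4 (λ a b x y → ((a ⊕ b) ⊕ (x ⊕ y)) ⊜ ((a ⊕ (x ⊕ b)) ⊕ y)) refl

  sign : ℕ → Carrier
  sign = pow R (- 1#)

  weight : ℕ → ℕ → Carrier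
  weight n k = ι (n C k) * sign k

  sign-suc : ∀ n k → ι (n C k) * sign (suc k) ≈ - weight n k
  sign-suc n k = trans (*-congˡ (-1*x≈-x (sign k))) (sym (-‿distribʳ-* _ _))

  weight-pascal : ∀ n k → weight (suc n) (suc k) ≈ weight n (suc k) - weight n k
  weight-pascal n k = begin
    ι (suc n C suc k) * sign (suc k)
      ≈⟨ *-congʳ (reflexive (≡.cong ι (≡.sym (nCk+nC[k+1]≡[n+1]C[k+1] n k)))) ⟩
    ι (n C k ℕ.+ n C suc k) * sign (suc k)      ≈⟨ *-congʳ (ι-+ (n C k) (n C suc k)) ⟩
    (ι (n C k) + ι (n C suc k)) * sign (suc k)  ≈⟨ distribʳ _ _ _ ⟩
    ι (n C k) * sign (suc k) + weight n (suc k) ≈⟨ +-congʳ (sign-suc n k) ⟩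
    - weight n k + weight n (suc k)             ≈⟨ +-comm _ _ ⟩
    weight n (suc k) - weight n k               ∎

  weight-absorb : ∀ n k → ι (suc k) * weight (suc n) (suc k) ≈ - ι (suc n) * weight n k
  weight-absorb n k = begin
    ι (suc k) * (ι (suc n C suc k) * sign (suc k))  ≈⟨ *-assoc _ _ _ ⟨
    (ι (suc k) * ι (suc n C suc k)) * sign (suc k)  ≈⟨ *-congʳ (ι-* (suc k) (suc n C suc k)) ⟨
    ι (suc k ℕ.* (suc n C suc k)) * sign (suc k)
      ≈⟨ *-congʳ (reflexive (≡.cong ι ([k+1]*[n+1]C[k+1]≡[n+1]*nCk n k))) ⟩
    ι (suc n ℕ.* (n C k)) * sign (suc k)            ≈⟨ *-congʳ (ι-* (suc n) (n C k)) ⟩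
    (ι (suc n) * ι (n C k)) * sign (suc k)          ≈⟨ *-assoc _ _ _ ⟩
    ι (suc n) * (ι (n C k) * sign (suc k))          ≈⟨ *-congˡ (sign-suc n k) ⟩
    ι (suc n) * - weight n k                        ≈⟨ -‿distribʳ-* _ _ ⟨
    - (ι (suc n) * weight n k)                      ≈⟨ -‿distribˡ-* _ _ ⟩
    - ι (suc n) * weight n k                        ∎

  weight-beyond : ∀ n → weight n (suc n) ≈ 0#
  weight-beyond n =
    trans (*-congʳ (reflexive (≡.cong ι (k>n⇒nCk≡0 (ℕₚ.n<1+n n))))) (zeroˡ (sign (suc n)))

  Δ : ℕ → (ℕ → Carrier) → Carrier
  Δ n g = sum0to R n (λ k → weight n k * g k)

  power : ℕ → ℕ → Carrier
  power m k = pow R (ι k) m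

  Δ-scale : ∀ n a g → Δ n (λ k → a * g k) ≈ a * Δ n g
  Δ-scale n a g = trans (sum-cong n (λ k → x∙yz≈y∙xz _ a _)) (sum-*ˡ n a _)

  Δ-pascal : ∀ n g → Δ (suc n) g ≈ Δ n g - Δ n (g ∘ suc)
  Δ-pascal n g = begin
    Δ (suc n) g
      ≈⟨ sum-shift n _ ⟩
    weight n 0 * g 0 + sum0to R n (λ k → weight (suc n) (suc k) * g (suc k))
      ≈⟨ +-congˡ (sum-cong n split) ⟩
    weight n 0 * g 0 + sum0to R n (λ k → weight n (suc k) * g (suc k) - weight n k * g (suc k))
      ≈⟨ +-congˡ (sum-- n _ _) ⟩
    weight n 0 * g 0 + (sum0to R n (λ k → weight n (suc k) * g (suc k)) - Δ n (g ∘ suc))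
      ≈⟨ +-assoc _ _ _ ⟨
    (weight n 0 * g 0 + sum0to R n (λ k → weight n (suc k) * g (suc k))) - Δ n (g ∘ suc)
      ≈⟨ +-congʳ (sum-shift n _) ⟨
    (Δ n g + weight n (suc n) * g (suc n)) - Δ n (g ∘ suc)
      ≈⟨ +-congʳ (+-congˡ (trans (*-congʳ (weight-beyond n)) (zeroˡ _))) ⟩
    (Δ n g + 0#) - Δ n (g ∘ suc)
      ≈⟨ +-congʳ (+-identityʳ _) ⟩
    Δ n g - Δ n (g ∘ suc) ∎
    where
    split : ∀ k → weight (suc n) (suc k) * g (suc k)
                ≈ weight n (suc k) * g (suc k) - weight n k * g (suc k)
    split k = trans (*-congʳ (weight-pascal n k)) ([y-z]x≈yx-zx _ _ _)

  Δ-difference : ∀ n g → Δ (suc n) g - Δ n g ≈ - Δ n (g ∘ suc)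
  Δ-difference n g = trans (+-congʳ (Δ-pascal n g)) (xyx⁻¹≈y (Δ n g) _)

  Δ-absorb : ∀ n g → Δ (suc n) (λ k → ι k * g k) ≈ - ι (suc n) * Δ n (g ∘ suc)
  Δ-absorb n g = begin
    Δ (suc n) (λ k → ι k * g k)
      ≈⟨ sum-shift n _ ⟩
    weight n 0 * (0# * g 0) + sum0to R n (λ k → weight (suc n) (suc k) * (ι (suc k) * g (suc k)))
      ≈⟨ +-cong (trans (*-congˡ (zeroˡ _)) (zeroʳ _)) (sum-cong n step) ⟩
    0# + sum0to R n (λ k → - ι (suc n) * (weight n k * g (suc k)))
      ≈⟨ +-identityˡ _ ⟩
    sum0to R n (λ k → - ι (suc n) * (weight n k * g (suc k)))
      ≈⟨ sum-*ˡ n _ _ ⟩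
    - ι (suc n) * Δ n (g ∘ suc) ∎
    where
    step : ∀ k → weight (suc n) (suc k) * (ι (suc k) * g (suc k))
               ≈ - ι (suc n) * (weight n k * g (suc k))
    step k = begin
      weight (suc n) (suc k) * (ι (suc k) * g (suc k)) ≈⟨ *-assoc _ _ _ ⟨
      (weight (suc n) (suc k) * ι (suc k)) * g (suc k) ≈⟨ *-congʳ (*-comm _ _) ⟩
      (ι (suc k) * weight (suc n) (suc k)) * g (suc k) ≈⟨ *-congʳ (weight-absorb n k) ⟩
      (- ι (suc n) * weight n k) * g (suc k)          ≈⟨ *-assoc _ _ _ ⟩
      - ι (suc n) * (weight n k * g (suc k))          ∎

  Δ-moment : ∀ n g → Δ (suc n) (λ k → ι k * g k) ≈ ι (suc n) * (Δ (suc n) g - Δ n g)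
  Δ-moment n g = begin
    Δ (suc n) (λ k → ι k * g k)         ≈⟨ Δ-absorb n g ⟩
    - ι (suc n) * Δ n (g ∘ suc)         ≈⟨ -‿distribˡ-* _ _ ⟨
    - (ι (suc n) * Δ n (g ∘ suc))       ≈⟨ -‿distribʳ-* _ _ ⟩
    ι (suc n) * - Δ n (g ∘ suc)         ≈⟨ *-congˡ (Δ-difference n g) ⟨
    ι (suc n) * (Δ (suc n) g - Δ n g)   ∎

  Δ-power-vanishes : ∀ {m n} → m < n → Δ n (power m) ≈ 0#
  Δ-power-vanishes {zero} {suc n} _ = trans (Δ-pascal n (power 0)) (-‿inverseʳ _)
  Δ-power-vanishes {suc m} {suc n} (s≤s m<n) = begin
    Δ (suc n) (power (suc m))                         ≈⟨ Δ-moment n (power m) ⟩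
    ι (suc n) * (Δ (suc n) (power m) - Δ n (power m))
      ≈⟨ *-congˡ (+-cong (Δ-power-vanishes (ℕₚ.m<n⇒m<1+n m<n)) (-‿cong (Δ-power-vanishes m<n))) ⟩
    ι (suc n) * (0# - 0#)                             ≈⟨ *-congˡ (-‿inverseʳ 0#) ⟩
    ι (suc n) * 0#                                    ≈⟨ zeroʳ _ ⟩
    0#                                                ∎

  Δ₀-power : ∀ m → Δ 0 (power m) ≈ pow R 0# m
  Δ₀-power m = trans (*-congʳ (trans (*-identityʳ _) (+-identityʳ 1#))) (*-identityˡ _)

  minusDerivAt0Z-scale : ∀ (f : PowerSeries R) m
                         → f m * minusDerivAt0Z R (λ _ → 1#) m ≈ minusDerivAt0Z R f m
  minusDerivAt0Z-scale f zero = zeroʳ (f 0)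
  minusDerivAt0Z-scale f (suc zero) = trans (sym (-‿distribʳ-* (f 1) 1#)) (-‿cong (*-identityʳ (f 1)))
  minusDerivAt0Z-scale f (suc (suc m)) = zeroʳ (f (suc (suc m)))

  -pow0≈-z : ∀ m → - pow R 0# m ≈ minusDerivAt0Z R (λ _ → 1#) (suc m)
  -pow0≈-z zero = refl
  -pow0≈-z (suc m) = trans (-‿cong (zeroˡ _)) -0#≈0#

  module Coefficients (inv : ℕ → Carrier) (inv-spec : ∀ j → ι (suc j) * inv j ≈ 1#) where

    S : ℕ → ℕ → Carrier
    S M m = sumBelow R M (λ j → inv j * Δ (suc j) (power m))

    -- The summands of S M (m+1) are backward differences in j, so it telescopes.
    S-telescopes : ∀ M m → S M (suc m) ≈ Δ M (power m) - Δ 0 (power m)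
    S-telescopes M m = trans (sumBelow-cong M difference) (sumBelow-telescope (λ j → Δ j (power m)) M)
      where
      difference : ∀ j → inv j * Δ (suc j) (power (suc m)) ≈ Δ (suc j) (power m) - Δ j (power m)
      difference j = begin
        inv j * Δ (suc j) (power (suc m))  ≈⟨ *-congˡ (Δ-moment j (power m)) ⟩
        inv j * (ι (suc j) * d)            ≈⟨ *-assoc _ _ _ ⟨
        (inv j * ι (suc j)) * d            ≈⟨ *-congʳ (trans (*-comm _ _) (inv-spec j)) ⟩
        1# * d                             ≈⟨ *-identityˡ d ⟩
        d                                  ∎
        where d = Δ (suc j) (power m) - Δ j (power m)

    S-stable : ∀ m M → m ≤ M → S M m ≈ minusDerivAt0Z R (λ _ → 1#) m
    S-stable zero M _ =
      sumBelow-vanishes M _ (λ j → trans (*-congˡ (Δ-power-vanishes {n = suc j} (s≤s z≤n))) (zeroʳ (inv j)))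
    S-stable (suc m) M m<M = begin
      S M (suc m)                               ≈⟨ S-telescopes M m ⟩
      Δ M (power m) - Δ 0 (power m)             ≈⟨ +-cong (Δ-power-vanishes m<M) (-‿cong (Δ₀-power m)) ⟩
      0# - pow R 0# m                           ≈⟨ +-identityˡ _ ⟩
      - pow R 0# m                              ≈⟨ -pow0≈-z m ⟩
      minusDerivAt0Z R (λ _ → 1#) (suc m)       ∎

    partialSum≈ : ∀ f M m → partialSum R inv f M m ≈ f m * S M m
    partialSum≈ f M m = trans (sumBelow-cong M factor) (sumBelow-*ˡ M (f m) _)
      where
      factor : ∀ j → term R (inv j) (suc j) f m ≈ f m * (inv j * Δ (suc j) (power m))
      factor j = trans (*-congˡ (Δ-scale (suc j) (f m) (power m))) (x∙yz≈y∙xz (inv j) (f m) _)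

proposition1 : {c ℓ : Level} (R : CommutativeRing c ℓ)
               (inv : ℕ → CommutativeRing.Carrier R)
               → (∀ j → CommutativeRing._≈_ R (CommutativeRing._*_ R (⟦_⟧ R (suc j)) (inv j)) (CommutativeRing.1# R))
               → (f : PowerSeries R)
               → ConvergesTo R (partialSum R inv f) (minusDerivAt0Z R f)
proposition1 R inv inv-spec f m = m , stable
  where
  open CommutativeRing R using (_*_; 1#; _≈_; *-congˡ; setoid)
  open SetoidReasoning setoid
  open Coefficients R inv inv-spec using (S; S-stable; partialSum≈)

  stable : ∀ M → m ≤ M → partialSum R inv f M m ≈ minusDerivAt0Z R f m
  stable M m≤M = begin
    partialSum R inv f M m                ≈⟨ partialSum≈ f M m ⟩
    f m * S M m                           ≈⟨ *-congˡ (S-stable m M m≤M) ⟩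
    f m * minusDerivAt0Z R (λ _ → 1#) m   ≈⟨ minusDerivAt0Z-scale R f m ⟩
    minusDerivAt0Z R f m                  ∎
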